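{- Let $\Gamma$ be a distance-regular graph with diameter $D\ge3$ and valency $k$, and let $\sigma_0,\dots,\sigma_D$ be the pseudo cosine sequence for $-k$. Suppose there is an integer $i$ with $1\le i\le D-2$ such that $\sigma_{i-1}+\sigma_i=0$ and $\sigma_{i+1}+\sigma_{i+2}=0$. Then $a_i=0$, $a_{i+1}=0$, and $\sigma_i+\sigma_{i+1}=0$.
   Context: $\Gamma$ is a finite, undirected, connected graph without loops or multiple edges, with path-length distance $\partial$ and diameter $D$. It is distance-regular: for all $0\le h,i,j\le D$ and all vertices $x,y$ with $\partial(x,y)=h$, the number $p^h_{ij}$ of vertices $z$ with $\partial(x,z)=i$, $\partial(y,z)=j$ depends only on $h,i,j$. Write $a_i=p^i_{1i}$, $b_i=p^i_{1,i+1}$ $(0\le i\le D-1)$, $c_i=p^i_{1,i-1}$ $(1\le i\le D)$, $c_0=0$, $b_D=0$, $k=b_0$. For $\theta\in\mathbb{R}$, the pseudo cosine sequence for $\theta$ is the sequence of reals $\sigma_0,\dots,\sigma_D$ with $\sigma_0=1$ and $c_i\sigma_{i-1}+a_i\sigma_i+b_i\sigma_{i+1}=\theta\sigma_i$ for $0\le i\le D-1$ (with $c_0\sigma_{ -1}=0$).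
   Formalization: The pseudo cosine sequence $\sigma_0,\dots,\sigma_D$ for $-k$ takes only rational values, rather than real ones. -}

module Defs where

open import Data.Nat using (ℕ; zero; suc; _+_; _≤_; _<_; _∸_; _≡ᵇ_)
open import Data.Fin using (Fin; _≟_)
open import Data.Bool using (Bool; true; false; _∧_; _∨_; not; if_then_else_)
open import Data.List using (List; map; allFin; upTo)
open import Data.Nat.ListAction using (sum)
open import Data.Bool.ListAction using (any)
open import Data.Product using (Σ; _×_; ∃-syntax)
open import Data.Integer using (+_)
open import Data.Rational using (ℚ; _/_)
open import Relation.Nullary.Decidable.Core using (does)
open import Relation.Binary.PropositionalEquality using (_≡_)

count : {n : ℕ} → (Fin n → Bool) → ℕ
count {n} f = sum (map (λ z → if f z then 1 else 0) (allFin n))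

reach : {n : ℕ} → (Fin n → Fin n → Bool) → ℕ → Fin n → Fin n → Bool
reach adj zero x y = does (x ≟ y)
reach {n} adj (suc d) x y = reach adj d x y ∨ any (λ z → adj x z ∧ reach adj d z y) (allFin n)

-- For a connected graph on n vertices this is the
-- least d with a walk of length d from x to y, i.e. the usual distance.
dist : {n : ℕ} → (Fin n → Fin n → Bool) → Fin n → Fin n → ℕ
dist {n} adj x y = sum (map (λ d → if reach adj d x y then 0 else 1) (upTo n))

record DRG : Set where
  field
    n        : ℕ
    adj      : Fin n → Fin n → Bool
    adj-sym  : ∀ x y → adj x y ≡ adj y x
    adj-irr  : ∀ x → adj x x ≡ false
    connected : ∀ x y → reach adj n x y ≡ true
    D        : ℕ
    diam-bound : ∀ x y → dist adj x y ≤ D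
    diam-attained : ∃[ x ] ∃[ y ] dist adj x y ≡ D
    p        : ℕ → ℕ → ℕ → ℕ
    regular  : ∀ h i j → h ≤ D → i ≤ D → j ≤ D → ∀ x y → dist adj x y ≡ h →
               count (λ z → (dist adj x z ≡ᵇ i) ∧ (dist adj y z ≡ᵇ j)) ≡ p h i j

module _ (Γ : DRG) where
  open DRG Γ

  aᵢ : ℕ → ℕ
  aᵢ i = p i 1 i

  bᵢ : ℕ → ℕ
  bᵢ i = p i 1 (suc i)

  cᵢ : ℕ → ℕ
  cᵢ zero = 0
  cᵢ (suc i) = p (suc i) 1 i

  valency : ℕ
  valency = bᵢ 0

ℕ→ℚ : ℕ → ℚ
ℕ→ℚ m = + m / 1

-- Write τⱼ = (−1)ʲ σⱼ, so that σⱼ + σⱼ₊₁ = 0 says exactly τⱼ₊₁ = τⱼ.  For θ = −k the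
-- three-term recurrence becomes
--   bⱼ (τⱼ₊₁ − τⱼ) = (2aⱼ + eⱼ) τⱼ + cⱼ (τⱼ − τⱼ₋₁),   eⱼ = k − aⱼ − bⱼ − cⱼ ≥ 0,
-- and τ₀ = τ₁ = 1, so by induction τ is nondecreasing and τⱼ ≥ 1.  Hence if τⱼ₊₁ = τⱼ,
-- both nonnegative terms on the right vanish: aⱼ = 0 and, as cⱼ > 0, τⱼ = τⱼ₋₁.
-- Starting from τᵢ₊₂ = τᵢ₊₁ this gives aᵢ₊₁ = 0 and τᵢ₊₁ = τᵢ, and then aᵢ = 0.

module Submission where

open import Defs

module RationalFacts where
  open import Data.Nat as ℕ using (ℕ; zero; suc)
  import Data.Integer as ℤ
  import Data.Integer.Properties as ℤ
  open import Data.Nat.Coprimality using (1-coprimeTo) renaming (sym to coprime-sym)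
  open import Data.Product using (_×_; _,_)
  open import Data.Rational
  open import Data.Rational.Properties
  open import Data.Rational.Solver using (module +-*-Solver)
  open import Relation.Binary.PropositionalEquality
  open import Relation.Nullary using (contradiction)
  open +-*-Solver

  ℕ→ℚ≡mkℚ : ∀ m → ℕ→ℚ m ≡ mkℚ (ℤ.+ m) 0 (coprime-sym (1-coprimeTo m))
  ℕ→ℚ≡mkℚ m = normalize-coprime (coprime-sym (1-coprimeTo m))

  ℕ→ℚ-+ : ∀ m n → ℕ→ℚ (m ℕ.+ n) ≡ ℕ→ℚ m + ℕ→ℚ n
  ℕ→ℚ-+ m n rewrite ℕ→ℚ≡mkℚ m | ℕ→ℚ≡mkℚ n =
    cong (_/ 1) (sym (cong₂ ℤ._+_ (ℤ.*-identityʳ (ℤ.+ m)) (ℤ.*-identityʳ (ℤ.+ n))))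

  0≤ℕ→ℚ : ∀ m → 0ℚ ≤ ℕ→ℚ m
  0≤ℕ→ℚ m = nonNegative⁻¹ (ℕ→ℚ m) {{normalize-nonNeg m 1}}

  0<ℕ→ℚ : ∀ {m} → 0 ℕ.< m → 0ℚ < ℕ→ℚ m
  0<ℕ→ℚ {suc m} _ = positive⁻¹ (ℕ→ℚ (suc m)) {{normalize-pos (suc m) 1}}

  ℕ→ℚ≡0⇒≡0 : ∀ m → ℕ→ℚ m ≡ 0ℚ → m ≡ 0
  ℕ→ℚ≡0⇒≡0 zero    _  = refl
  ℕ→ℚ≡0⇒≡0 (suc m) eq = contradiction (sym eq) (<⇒≢ (0<ℕ→ℚ {suc m} (ℕ.s≤s ℕ.z≤n)))

  *-nonNeg : ∀ {p q} → 0ℚ ≤ p → 0ℚ ≤ q → 0ℚ ≤ p * q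
  *-nonNeg {p} {q} 0≤p 0≤q =
    nonNegative⁻¹ (p * q) {{nonNeg*nonNeg⇒nonNeg p {{nonNegative 0≤p}} q {{nonNegative 0≤q}}}}

  p≤q⇒0≤q-p : ∀ {p q} → p ≤ q → 0ℚ ≤ q - p
  p≤q⇒0≤q-p {p} {q} p≤q = subst (_≤ q - p) (+-inverseʳ p) (+-monoˡ-≤ (- p) p≤q)

  0≤q-p⇒p≤q : ∀ {p q} → 0ℚ ≤ q - p → p ≤ q
  0≤q-p⇒p≤q {p} {q} 0≤q-p = subst₂ _≤_ (+-identityʳ p) p+[q-p]≡q (+-monoʳ-≤ p 0≤q-p)
    where
    p+[q-p]≡q : p + (q - p) ≡ q
    p+[q-p]≡q = solve 2 (λ p q → p :+ (q :- p) := q) refl p q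

  0≤p*q⇒0≤q : ∀ {p q} → 0ℚ < p → 0ℚ ≤ p * q → 0ℚ ≤ q
  0≤p*q⇒0≤q {p} {q} 0<p 0≤pq =
    *-cancelˡ-≤-pos p {{positive 0<p}} (subst (_≤ p * q) (sym (*-zeroʳ p)) 0≤pq)

  p*q≡0⇒p≡0 : ∀ {p q} → 0ℚ < q → p * q ≡ 0ℚ → p ≡ 0ℚ
  p*q≡0⇒p≡0 {p} {q} 0<q pq≡0 = ≤-antisym
    (*-cancelʳ-≤-pos q {{positive 0<q}} (subst₂ _≤_ (sym pq≡0) (sym (*-zeroˡ q)) ≤-refl))
    (*-cancelʳ-≤-pos q {{positive 0<q}} (subst₂ _≤_ (sym (*-zeroˡ q)) (sym pq≡0) ≤-refl))

  nonNeg-sum≡0 : ∀ {p q} → 0ℚ ≤ p → 0ℚ ≤ q → p + q ≡ 0ℚ → p ≡ 0ℚ × q ≡ 0ℚ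
  nonNeg-sum≡0 {p} {q} 0≤p 0≤q p+q≡0 =
    ≤-antisym (subst₂ _≤_ (+-identityʳ p) p+q≡0 (+-monoʳ-≤ p 0≤q)) 0≤p ,
    ≤-antisym (subst₂ _≤_ (+-identityˡ q) p+q≡0 (+-monoˡ-≤ q 0≤p)) 0≤q

  p-q≡0⇒p≡q : ∀ {p q} → p - q ≡ 0ℚ → p ≡ q
  p-q≡0⇒p≡q {p} {q} p-q≡0 = begin
    p            ≡⟨ solve 2 (λ p q → p := (p :- q) :+ q) refl p q ⟩
    (p - q) + q  ≡⟨ cong (_+ q) p-q≡0 ⟩
    0ℚ + q       ≡⟨ +-identityˡ q ⟩
    q            ∎
    where open ≡-Reasoning

  nondecreasing-step : ∀ {B K C t₀ t₁ t₂} → 0ℚ < B → 0ℚ ≤ K → 0ℚ ≤ C → 0ℚ ≤ t₁ → t₀ ≤ t₁ →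
    B * (t₂ - t₁) ≡ K * t₁ + C * (t₁ - t₀) → t₁ ≤ t₂
  nondecreasing-step 0<B 0≤K 0≤C 0≤t₁ t₀≤t₁ step =
    0≤q-p⇒p≤q (0≤p*q⇒0≤q 0<B (subst (0ℚ ≤_) (sym step)
      (+-mono-≤ (*-nonNeg 0≤K 0≤t₁) (*-nonNeg 0≤C (p≤q⇒0≤q-p t₀≤t₁)))))

module AlternatingSign where
  open import Data.Nat using (ℕ; zero; suc)
  open import Data.Rational
  open import Data.Rational.Properties
  open import Data.Rational.Solver using (module +-*-Solver)
  open import Relation.Binary.PropositionalEquality
  open +-*-Solver

  sgn : ℕ → ℚ
  sgn zero    = 1ℚ
  sgn (suc j) = - sgn j

  alternate : (ℕ → ℚ) → ℕ → ℚ
  alternate σ j = sgn j * σ j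

  sgn*sgn≡1 : ∀ j → sgn j * sgn j ≡ 1ℚ
  sgn*sgn≡1 zero    = refl
  sgn*sgn≡1 (suc j) = trans (solve 1 (λ s → (:- s) :* (:- s) := s :* s) refl (sgn j)) (sgn*sgn≡1 j)

  alternate-diff : ∀ σ j → alternate σ (suc j) - alternate σ j ≡ - sgn j * (σ j + σ (suc j))
  alternate-diff σ j =
    solve 3 (λ s x y → (:- s) :* y :- s :* x := (:- s) :* (x :+ y)) refl (sgn j) (σ j) (σ (suc j))

  sum≡0⇒alternate-flat : ∀ σ j → σ j + σ (suc j) ≡ 0ℚ → alternate σ (suc j) - alternate σ j ≡ 0ℚ
  sum≡0⇒alternate-flat σ j sum≡0 = begin
    alternate σ (suc j) - alternate σ j ≡⟨ alternate-diff σ j ⟩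
    - sgn j * (σ j + σ (suc j))          ≡⟨ cong (- sgn j *_) sum≡0 ⟩
    - sgn j * 0ℚ                         ≡⟨ *-zeroʳ (- sgn j) ⟩
    0ℚ                                   ∎
    where open ≡-Reasoning

  alternate-flat⇒sum≡0 : ∀ σ j → alternate σ (suc j) - alternate σ j ≡ 0ℚ → σ j + σ (suc j) ≡ 0ℚ
  alternate-flat⇒sum≡0 σ j flat = begin
    x                    ≡⟨ *-identityˡ x ⟨
    1ℚ * x               ≡⟨ cong (_* x) (sgn*sgn≡1 j) ⟨
    (s * s) * x          ≡⟨ solve 2 (λ s x → (s :* s) :* x := (:- s) :* ((:- s) :* x)) refl s x ⟩
    - s * (- s * x)      ≡⟨ cong (- s *_) (trans (sym (alternate-diff σ j)) flat) ⟩
    - s * 0ℚ             ≡⟨ *-zeroʳ (- s) ⟩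
    0ℚ                   ∎
    where
    open ≡-Reasoning
    s x : ℚ
    s = sgn j
    x = σ j + σ (suc j)

  alternate-recurrence : ∀ (s a b c e x y z : ℚ) →
    c * x + a * y + b * z ≡ (- (a + b + c + e)) * y →
    b * (- (- s) * z - (- s) * y) ≡ (a + a + e) * ((- s) * y) + c * ((- s) * y - s * x)
  alternate-recurrence s a b c e x y z rec = begin
    b * (- (- s) * z - (- s) * y)  ≡⟨ solve 8 (λ s a b c e x y z →
        b :* ((:- (:- s)) :* z :- (:- s) :* y)
        := ((a :+ a :+ e) :* ((:- s) :* y) :+ c :* ((:- s) :* y :- s :* x))
           :+ s :* ((c :* x :+ a :* y :+ b :* z) :- (:- (a :+ b :+ c :+ e)) :* y))
        refl s a b c e x y z ⟩
    R + s * (L - M)                ≡⟨ cong (λ t → R + s * (t - M)) rec ⟩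
    R + s * (M - M)                ≡⟨ cong (λ t → R + s * t) (+-inverseʳ M) ⟩
    R + s * 0ℚ                     ≡⟨ cong (R +_) (*-zeroʳ s) ⟩
    R + 0ℚ                         ≡⟨ +-identityʳ R ⟩
    R                              ∎
    where
    open ≡-Reasoning
    L M R : ℚ
    L = c * x + a * y + b * z
    M = (- (a + b + c + e)) * y
    R = (a + a + e) * ((- s) * y) + c * ((- s) * y - s * x)

module Counting where
  open import Data.Bool using (Bool; true; false; T; _∧_; if_then_else_)
  open import Data.Fin using (Fin)
  open import Data.List using ([]; _∷_; map; allFin; applyUpTo)
  open import Data.List.Membership.Propositional using (_∈_)
  open import Data.List.Membership.Propositional.Properties using (∈-allFin)
  open import Data.List.Relation.Unary.Any using (here; there)
  open import Data.Nat using (ℕ; zero; suc; _+_; _≤_; _≡ᵇ_; z≤n; s≤s)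
  open import Data.Nat.ListAction using (sum)
  open import Data.Nat.Properties
  open import Algebra.Properties.CommutativeSemigroup +-commutativeSemigroup using (interchange)
  open import Data.Empty using (⊥-elim)
  open import Function using (_∘_)
  open import Relation.Nullary using (¬_; yes; no)
  open import Relation.Nullary.Decidable.Core using (T?)
  open import Relation.Binary.PropositionalEquality

  indicator : Bool → ℕ
  indicator b = if b then 1 else 0

  indicator≤1 : ∀ b → indicator b ≤ 1
  indicator≤1 true  = s≤s z≤n
  indicator≤1 false = z≤n

  ∧-indicators≤ : ∀ u b₁ b₂ b₃ → indicator b₁ + indicator b₂ + indicator b₃ ≤ 1 →
    indicator (u ∧ b₁) + indicator (u ∧ b₂) + indicator (u ∧ b₃) ≤ indicator (u ∧ u)
  ∧-indicators≤ true  _ _ _ ≤1 = ≤1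
  ∧-indicators≤ false _ _ _ _  = z≤n

  ≡ᵇ-indicators-consecutive : ∀ e j →
    indicator (e ≡ᵇ suc j) + indicator (e ≡ᵇ suc (suc j)) + indicator (e ≡ᵇ j) ≤ 1
  ≡ᵇ-indicators-consecutive zero          zero    = ≤-refl
  ≡ᵇ-indicators-consecutive zero          (suc j) = z≤n
  ≡ᵇ-indicators-consecutive (suc zero)    zero    = ≤-refl
  ≡ᵇ-indicators-consecutive (suc (suc e)) zero    = ≤-trans (≤-reflexive (+-identityʳ _)) (indicator≤1 (e ≡ᵇ 0))
  ≡ᵇ-indicators-consecutive (suc e)       (suc j) = ≡ᵇ-indicators-consecutive e j

  sum-map-+ : ∀ {A : Set} (F G : A → ℕ) xs →
    sum (map F xs) + sum (map G xs) ≡ sum (map (λ z → F z + G z) xs)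
  sum-map-+ F G []       = refl
  sum-map-+ F G (x ∷ xs) =
    trans (interchange (F x) (sum (map F xs)) (G x) (sum (map G xs))) (cong (F x + G x +_) (sum-map-+ F G xs))

  sum-map-mono-≤ : ∀ {A : Set} {F G : A → ℕ} → (∀ z → F z ≤ G z) → ∀ xs → sum (map F xs) ≤ sum (map G xs)
  sum-map-mono-≤ F≤G []       = z≤n
  sum-map-mono-≤ F≤G (x ∷ xs) = +-mono-≤ (F≤G x) (sum-map-mono-≤ F≤G xs)

  ∈⇒≤sum-map : ∀ {A : Set} (F : A → ℕ) {z xs} → z ∈ xs → F z ≤ sum (map F xs)
  ∈⇒≤sum-map F {xs = x ∷ xs} (here refl) = m≤m+n (F x) _
  ∈⇒≤sum-map F {xs = x ∷ xs} (there z∈xs) = ≤-trans (∈⇒≤sum-map F z∈xs) (m≤n+m _ (F x))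

  sum-map-zero : ∀ {A : Set} {F : A → ℕ} → (∀ z → F z ≡ 0) → ∀ xs → sum (map F xs) ≡ 0
  sum-map-zero F≡0 []       = refl
  sum-map-zero F≡0 (x ∷ xs) = cong₂ _+_ (F≡0 x) (sum-map-zero F≡0 xs)

  module _ {n : ℕ} where

    count-pos : (f : Fin n → Bool) (z : Fin n) → T (f z) → 1 ≤ count f
    count-pos f z fz = ≤-trans (indicator-true fz) (∈⇒≤sum-map (λ z → indicator (f z)) (∈-allFin z))
      where
      indicator-true : ∀ {b} → T b → 1 ≤ indicator b
      indicator-true {true} _ = s≤s z≤n

    count-none : (f : Fin n → Bool) → (∀ z → ¬ T (f z)) → count f ≡ 0
    count-none f none = sum-map-zero indicator-false (allFin n)
      where
      indicator-false : ∀ z → indicator (f z) ≡ 0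
      indicator-false z with f z | none z
      ... | true  | ¬T = ⊥-elim (¬T _)
      ... | false | _  = refl

    count-disjoint₃-≤ : (f g h u : Fin n → Bool) →
      (∀ z → indicator (f z) + indicator (g z) + indicator (h z) ≤ indicator (u z)) →
      count f + count g + count h ≤ count u
    count-disjoint₃-≤ f g h u pointwise = begin
      count f + count g + count h
        ≡⟨ cong (_+ count h) (sum-map-+ (λ z → indicator (f z)) (λ z → indicator (g z)) (allFin n)) ⟩
      sum (map (λ z → indicator (f z) + indicator (g z)) (allFin n)) + count h
        ≡⟨ sum-map-+ (λ z → indicator (f z) + indicator (g z)) (λ z → indicator (h z)) (allFin n) ⟩
      sum (map (λ z → indicator (f z) + indicator (g z) + indicator (h z)) (allFin n))
        ≤⟨ sum-map-mono-≤ pointwise (allFin n) ⟩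
      count u ∎
      where open ≤-Reasoning

  falseIndicator : Bool → ℕ
  falseIndicator b = if b then 0 else 1

  falseIndicator≤1 : ∀ b → falseIndicator b ≤ 1
  falseIndicator≤1 true  = z≤n
  falseIndicator≤1 false = s≤s z≤n

  T⇒falseIndicator≡0 : ∀ {b} → T b → falseIndicator b ≡ 0
  T⇒falseIndicator≡0 {true} _ = refl

  ¬T⇒falseIndicator≡1 : ∀ {b} → ¬ T b → falseIndicator b ≡ 1
  ¬T⇒falseIndicator≡1 {true}  ¬T = ⊥-elim (¬T _)
  ¬T⇒falseIndicator≡1 {false} _  = refl

  falsesBelow : (ℕ → Bool) → ℕ → ℕ
  falsesBelow r m = sum (applyUpTo (λ d → falseIndicator (r d)) m)

  Monotone : (ℕ → Bool) → Set
  Monotone r = ∀ d → T (r d) → T (r (suc d))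

  monotone-≤ : ∀ {r} → Monotone r → ∀ {d e} → d ≤ e → T (r d) → T (r e)
  monotone-≤ mono {e = zero}  z≤n   rd = rd
  monotone-≤ mono {e = suc e} z≤n   rd = mono e (monotone-≤ mono z≤n rd)
  monotone-≤ mono (s≤s d≤e) rd = monotone-≤ (mono ∘ suc) d≤e rd

  falsesBelow≡0 : ∀ {r} → Monotone r → T (r 0) → ∀ m → falsesBelow r m ≡ 0
  falsesBelow≡0 mono r0 zero    = refl
  falsesBelow≡0 mono r0 (suc m) =
    cong₂ _+_ (T⇒falseIndicator≡0 r0) (falsesBelow≡0 (mono ∘ suc) (mono 0 r0) m)

  falsesBelow≤ : ∀ {r} → Monotone r → ∀ {d} → T (r d) → ∀ m → falsesBelow r m ≤ d
  falsesBelow≤ mono {zero}  rd m       = ≤-reflexive (falsesBelow≡0 mono rd m)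
  falsesBelow≤ mono {suc d} rd zero    = z≤n
  falsesBelow≤ {r} mono {suc d} rd (suc m) =
    +-mono-≤ (falseIndicator≤1 (r 0)) (falsesBelow≤ (mono ∘ suc) rd m)

  falsesBelow≤⇒T : ∀ {r} → Monotone r → ∀ {m} → T (r m) → ∀ {d} → falsesBelow r m ≤ d → T (r d)
  falsesBelow≤⇒T mono {zero} r0 _ = monotone-≤ mono z≤n r0
  falsesBelow≤⇒T {r} mono {suc m} rm {d} below with T? (r 0)
  ... | yes r0 = monotone-≤ mono z≤n r0
  ... | no ¬r0 = from-suc (subst (_≤ d) (cong (_+ falsesBelow (r ∘ suc) m) (¬T⇒falseIndicator≡1 ¬r0)) below)
    where
    from-suc : ∀ {e} → suc (falsesBelow (r ∘ suc) m) ≤ e → T (r e)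
    from-suc (s≤s below′) = falsesBelow≤⇒T (mono ∘ suc) rm below′

module Distance (Γ : DRG) where
  open import Data.Bool using (T)
  open import Data.Bool.Properties using (T-∨; T-∧; T-≡)
  open import Data.Fin using (Fin; _≟_)
  open import Data.List using (allFin)
  open import Data.List.Properties using (map-upTo)
  open import Data.List.Membership.Propositional using (lose)
  open import Data.List.Membership.Propositional.Properties using (∈-allFin)
  open import Data.List.Relation.Unary.Any using (satisfied)
  open import Data.List.Relation.Unary.Any.Properties using (any⁺; any⁻)
  open import Data.Nat using (ℕ; zero; suc; _+_; _∸_; _≤_; s≤s⁻¹)
  open import Data.Nat.ListAction using (sum)
  open import Data.Nat.Properties using (≤-antisym; ≤-refl; ≤-reflexive; n≤0⇒n≡0; n≢0⇒n>0; n≮n; m∸n+n≡m)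
  open import Data.Product using (_×_; _,_; ∃-syntax)
  open import Data.Sum using (_⊎_; inj₁; inj₂)
  open import Function using (Equivalence; _∘_)
  open import Relation.Nullary using (¬_; contradiction)
  open import Relation.Nullary.Decidable using (yes; dec-true)
  open import Relation.Binary.PropositionalEquality
  open Counting
  open DRG Γ
  open Equivalence using (to; from)

  Adj : Fin n → Fin n → Set
  Adj x y = T (adj x y)

  -- A record rather than T (reach adj d x y), so that d, x and y can be inferred.
  record Reach (d : ℕ) (x y : Fin n) : Set where
    constructor reached
    field walk : T (reach adj d x y)
  open Reach

  Adj-sym : ∀ {x y} → Adj x y → Adj y x
  Adj-sym {x} {y} = subst T (adj-sym x y)

  Adj-irrefl : ∀ x → ¬ Adj x x
  Adj-irrefl x = subst T (adj-irr x)

  reach-mono : ∀ d {x y} → Reach d x y → Reach (suc d) x y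
  reach-mono d r = reached (from T-∨ (inj₁ (walk r)))

  reach-refl : ∀ x → Reach 0 x x
  reach-refl x = reached (from T-≡ (dec-true (x ≟ x) refl))

  reach-zero⇒≡ : ∀ {x y} → Reach 0 x y → x ≡ y
  reach-zero⇒≡ {x} {y} (reached r) with x ≟ y
  ... | yes x≡y = x≡y

  reach-step : ∀ {d x y z} → Adj x z → Reach d z y → Reach (suc d) x y
  reach-step {z = z} xz (reached zy) =
    reached (from T-∨ (inj₂ (any⁺ _ (lose (∈-allFin z) (from T-∧ (xz , zy))))))

  reach-suc⁻ : ∀ {d x y} → Reach (suc d) x y → Reach d x y ⊎ ∃[ z ] Adj x z × Reach d z y
  reach-suc⁻ (reached r) with to T-∨ r
  ... | inj₁ r′ = inj₁ (reached r′)
  ... | inj₂ r′ with satisfied (any⁻ _ (allFin n) r′)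
  ...   | z , xzy with to T-∧ xzy
  ...     | xz , zy = inj₂ (z , xz , reached zy)

  reach-snoc : ∀ d {x y t} → Reach d x y → Adj y t → Reach (suc d) x t
  reach-snoc zero r yt with reach-zero⇒≡ r
  ... | refl = reach-step yt (reach-refl _)
  reach-snoc (suc d) r yt with reach-suc⁻ r
  ... | inj₁ r′           = reach-mono (suc d) (reach-snoc d r′ yt)
  ... | inj₂ (z , xz , r′) = reach-step xz (reach-snoc d r′ yt)

  reach-sym : ∀ d {x y} → Reach d x y → Reach d y x
  reach-sym zero r with reach-zero⇒≡ r
  ... | refl = r
  reach-sym (suc d) r with reach-suc⁻ r
  ... | inj₁ r′           = reach-mono d (reach-sym d r′)
  ... | inj₂ (z , xz , r′) = reach-snoc d (reach-sym d r′) (Adj-sym xz)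

  dist≡falsesBelow : ∀ x y → dist adj x y ≡ falsesBelow (λ d → reach adj d x y) n
  dist≡falsesBelow x y = cong sum (map-upTo _ n)

  reach⇒dist≤ : ∀ {d x y} → Reach d x y → dist adj x y ≤ d
  reach⇒dist≤ {x = x} {y} r =
    subst (_≤ _) (sym (dist≡falsesBelow x y)) (falsesBelow≤ (λ d → walk ∘ reach-mono d ∘ reached) (walk r) n)

  dist≤⇒reach : ∀ {d x y} → dist adj x y ≤ d → Reach d x y
  dist≤⇒reach {x = x} {y} le =
    reached (falsesBelow≤⇒T (λ d → walk ∘ reach-mono d ∘ reached) {n} (from T-≡ (connected x y))
                              (subst (_≤ _) (dist≡falsesBelow x y) le))

  dist-sym : ∀ x y → dist adj x y ≡ dist adj y x
  dist-sym x y = ≤-antisym (one-way x y) (one-way y x)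
    where
    one-way : ∀ x y → dist adj x y ≤ dist adj y x
    one-way x y = reach⇒dist≤ (reach-sym _ (dist≤⇒reach ≤-refl))

  dist-refl : ∀ x → dist adj x x ≡ 0
  dist-refl x = n≤0⇒n≡0 (reach⇒dist≤ (reach-refl x))

  adj⇒dist≡1 : ∀ {x y} → Adj x y → dist adj x y ≡ 1
  adj⇒dist≡1 {x} {y} xy = ≤-antisym (reach⇒dist≤ (reach-step xy (reach-refl y))) (n≢0⇒n>0 dist≢0)
    where
    dist≢0 : dist adj x y ≢ 0
    dist≢0 d≡0 with reach-zero⇒≡ (dist≤⇒reach (≤-reflexive d≡0))
    ... | refl = Adj-irrefl x xy

  geodesic-step : ∀ {u v m} → dist adj u v ≡ suc m → ∃[ w ] Adj u w × dist adj w v ≡ m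
  geodesic-step {u} {v} {m} uv with reach-suc⁻ (dist≤⇒reach (≤-reflexive uv))
  ... | inj₁ r = contradiction (subst (_≤ m) uv (reach⇒dist≤ r)) (n≮n m)
  ... | inj₂ (w , uw , r) = w , uw , ≤-antisym (reach⇒dist≤ r) m≤dist
    where
    m≤dist : m ≤ dist adj w v
    m≤dist = s≤s⁻¹ (subst (_≤ _) uv (reach⇒dist≤ (reach-step uw (dist≤⇒reach ≤-refl))))

  distance-realised : ∀ j → j ≤ D → ∃[ x ] ∃[ y ] dist adj x y ≡ j
  distance-realised j j≤D with diam-attained
  ... | x , y , xy≡D = descend (D ∸ j) x (trans xy≡D (sym (m∸n+n≡m j≤D)))
    where
    descend : ∀ t u → dist adj u y ≡ t + j → ∃[ x ] ∃[ y ] dist adj x y ≡ j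
    descend zero    u uy = u , y , uy
    descend (suc t) u uy with geodesic-step uy
    ... | w , _ , wy = descend t w wy

module IntersectionNumbers (Γ : DRG) where
  open import Data.Bool using (Bool; T; _∧_)
  open import Data.Bool.Properties using (T-∧)
  open import Data.Fin using (Fin)
  open import Data.Nat using (ℕ; suc; _+_; _≤_; _<_; _≡ᵇ_; z≤n; s≤s)
  open import Data.Nat.Properties using (≤-trans; <⇒≤; n≤1+n; ≡ᵇ⇒≡; ≡⇒≡ᵇ; 1+n≢0; module ≤-Reasoning)
  open import Data.Product using (_,_)
  open import Function using (Equivalence)
  open import Relation.Nullary using (¬_)
  open import Relation.Binary.PropositionalEquality
  open Counting
  open DRG Γ
  open Distance Γ
  open Equivalence using (to; from)

  at-distances : ∀ {x y z i j} → dist adj x z ≡ i → dist adj y z ≡ j → T ((dist adj x z ≡ᵇ i) ∧ (dist adj y z ≡ᵇ j))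
  at-distances xz yz = from T-∧ (≡⇒≡ᵇ _ _ xz , ≡⇒≡ᵇ _ _ yz)

  a₀≡0 : 1 ≤ D → aᵢ Γ 0 ≡ 0
  a₀≡0 1≤D with diam-attained
  ... | x , _ = trans (sym (regular 0 1 0 z≤n 1≤D z≤n x x (dist-refl x))) (count-none _ not-both)
    where
    not-both : ∀ z → ¬ T ((dist adj x z ≡ᵇ 1) ∧ (dist adj x z ≡ᵇ 0))
    not-both z both with to (T-∧ {dist adj x z ≡ᵇ 1}) both
    ... | is1 , is0 = 1+n≢0 (trans (sym (≡ᵇ⇒≡ (dist adj x z) 1 is1)) (≡ᵇ⇒≡ (dist adj x z) 0 is0))

  bᵢ-pos : ∀ j → j < D → 0 < bᵢ Γ j
  bᵢ-pos j j<D with distance-realised (suc j) j<D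
  ... | u , v , uv with geodesic-step uv
  ... | w , uw , wv = subst (1 ≤_) (regular j 1 (suc j) (<⇒≤ j<D) (≤-trans (s≤s z≤n) j<D) j<D w v wv)
                        (count-pos _ u (at-distances (adj⇒dist≡1 (Adj-sym uw)) (trans (dist-sym v u) uv)))

  cᵢ-pos : ∀ j → suc j ≤ D → 0 < cᵢ Γ (suc j)
  cᵢ-pos j j<D with distance-realised (suc j) j<D
  ... | u , v , uv with geodesic-step uv
  ... | w , uw , wv = subst (1 ≤_) (regular (suc j) 1 j j<D (≤-trans (s≤s z≤n) j<D) (<⇒≤ j<D) u v uv)
                        (count-pos _ w (at-distances (adj⇒dist≡1 uw) (trans (dist-sym v w) wv)))

  a+b+c≤k : ∀ j → suc j < D → aᵢ Γ (suc j) + bᵢ Γ (suc j) + cᵢ Γ (suc j) ≤ valency Γ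
  a+b+c≤k j j+1<D with distance-realised (suc j) (<⇒≤ j+1<D)
  ... | x , y , xy = begin
    aᵢ Γ (suc j) + bᵢ Γ (suc j) + cᵢ Γ (suc j)
      ≡⟨ cong₂ _+_ (cong₂ _+_ (regular′ (suc j) (<⇒≤ j+1<D)) (regular′ (suc (suc j)) j+1<D))
                   (regular′ j (≤-trans (n≤1+n j) (<⇒≤ j+1<D))) ⟨
    count (near (suc j)) + count (near (suc (suc j))) + count (near j)
      ≤⟨ count-disjoint₃-≤ _ _ _ _ (λ z → ∧-indicators≤ (dist adj x z ≡ᵇ 1) _ _ _
                                           (≡ᵇ-indicators-consecutive (dist adj y z) j)) ⟩
    count (λ z → (dist adj x z ≡ᵇ 1) ∧ (dist adj x z ≡ᵇ 1))
      ≡⟨ regular 0 1 1 z≤n 1≤D 1≤D x x (dist-refl x) ⟩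
    valency Γ ∎
    where
    open ≤-Reasoning
    1≤D : 1 ≤ D
    1≤D = ≤-trans (s≤s z≤n) (<⇒≤ j+1<D)
    near : ℕ → Fin n → Bool
    near i z = (dist adj x z ≡ᵇ 1) ∧ (dist adj y z ≡ᵇ i)
    regular′ : ∀ i → i ≤ D → count (near i) ≡ p (suc j) 1 i
    regular′ i i≤D = regular (suc j) 1 i (<⇒≤ j+1<D) 1≤D i≤D x y xy

open import Data.Nat using (ℕ; suc; _≤_; _<_; _∸_)
open import Data.Product using (_×_)
open import Data.Rational using (ℚ; _+_; _*_; -_; 0ℚ; 1ℚ)
open import Relation.Binary.PropositionalEquality using (_≡_)
open import Data.Rational using (_-_)

module PseudoCosine (Γ : DRG) (σ : ℕ → ℚ) (σ₀ : σ 0 ≡ 1ℚ)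
  (σ-rec : ∀ i → i < DRG.D Γ →
    ℕ→ℚ (cᵢ Γ i) * σ (i ∸ 1) + ℕ→ℚ (aᵢ Γ i) * σ i + ℕ→ℚ (bᵢ Γ i) * σ (suc i)
      ≡ (- ℕ→ℚ (valency Γ)) * σ i) where
  open import Data.Nat using (zero; z≤n; s≤s)
  import Data.Nat as ℕ
  open import Data.Nat.Properties using (<⇒≤; m+[n∸m]≡n; m+n≡0⇒m≡0)
  open import Data.Product using (_,_; proj₁; proj₂)
  import Data.Rational as ℚ
  open import Data.Rational.Properties
    using (*-identityˡ; *-comm; *-zeroʳ; +-inverseʳ; ≤-reflexive; ≤-trans; <-≤-trans)
    renaming (<⇒≤ to <⇒≤ℚ)
  open import Data.Rational.Solver using (module +-*-Solver)
  open import Relation.Binary.PropositionalEquality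
  open DRG Γ using (D)
  open RationalFacts
  open AlternatingSign
  open IntersectionNumbers Γ
  open +-*-Solver

  τ : ℕ → ℚ
  τ = alternate σ

  τ₀≡1 : τ 0 ≡ 1ℚ
  τ₀≡1 = trans (*-identityˡ (σ 0)) σ₀

  τ₁≡1 : 0 < D → τ 1 ≡ 1ℚ
  τ₁≡1 0<D = trans (p-q≡0⇒p≡q (sum≡0⇒alternate-flat σ 0 σ₀+σ₁≡0)) τ₀≡1
    where
    k M : ℚ
    k = ℕ→ℚ (valency Γ)
    M = (- k) * σ 0
    rec₀ : 0ℚ * σ 0 + 0ℚ * σ 0 + k * σ 1 ≡ M
    rec₀ = subst (λ a → 0ℚ * σ 0 + ℕ→ℚ a * σ 0 + k * σ 1 ≡ M) (a₀≡0 0<D) (σ-rec 0 0<D)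
    σ₀+σ₁≡0 : σ 0 + σ 1 ≡ 0ℚ
    σ₀+σ₁≡0 = p*q≡0⇒p≡0 (0<ℕ→ℚ (bᵢ-pos 0 0<D)) (begin
      (σ 0 + σ 1) * k                         ≡⟨ solve 3 (λ x y k → (x :+ y) :* k
                                                    := (con 0ℚ :* x :+ con 0ℚ :* x :+ k :* y) :- (:- k) :* x)
                                                    refl (σ 0) (σ 1) k ⟩
      (0ℚ * σ 0 + 0ℚ * σ 0 + k * σ 1) - M     ≡⟨ cong (_- M) rec₀ ⟩
      M - M                                    ≡⟨ +-inverseʳ M ⟩
      0ℚ                                       ∎)
      where open ≡-Reasoning

  -- k + aⱼ − bⱼ − cⱼ written without negative terms; the truncated subtraction is exact
  -- in the range where a+b+c≤k applies.
  K : ℕ → ℕ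
  K j = aᵢ Γ j ℕ.+ aᵢ Γ j ℕ.+ (valency Γ ∸ (aᵢ Γ j ℕ.+ bᵢ Γ j ℕ.+ cᵢ Γ j))

  τ-recurrence : ∀ j → suc j < D →
    ℕ→ℚ (bᵢ Γ (suc j)) * (τ (suc (suc j)) - τ (suc j))
      ≡ ℕ→ℚ (K (suc j)) * τ (suc j) + ℕ→ℚ (cᵢ Γ (suc j)) * (τ (suc j) - τ j)
  τ-recurrence j j+1<D = begin
    B * (τ (suc (suc j)) - τ (suc j))
      ≡⟨ alternate-recurrence (sgn j) A B C E (σ j) (σ (suc j)) (σ (suc (suc j))) σ-rec′ ⟩
    (A + A + E) * τ (suc j) + C * (τ (suc j) - τ j)
      ≡⟨ cong (λ t → t * τ (suc j) + C * (τ (suc j) - τ j)) K≡ ⟨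
    ℕ→ℚ (K (suc j)) * τ (suc j) + C * (τ (suc j) - τ j) ∎
    where
    open ≡-Reasoning
    a b c e : ℕ
    a = aᵢ Γ (suc j)
    b = bᵢ Γ (suc j)
    c = cᵢ Γ (suc j)
    e = valency Γ ∸ (a ℕ.+ b ℕ.+ c)
    A B C E : ℚ
    A = ℕ→ℚ a
    B = ℕ→ℚ b
    C = ℕ→ℚ c
    E = ℕ→ℚ e
    k≡ : ℕ→ℚ (valency Γ) ≡ A + B + C + E
    k≡ = begin
      ℕ→ℚ (valency Γ)           ≡⟨ cong ℕ→ℚ (m+[n∸m]≡n (a+b+c≤k j j+1<D)) ⟨
      ℕ→ℚ (a ℕ.+ b ℕ.+ c ℕ.+ e) ≡⟨ ℕ→ℚ-+ (a ℕ.+ b ℕ.+ c) e ⟩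
      ℕ→ℚ (a ℕ.+ b ℕ.+ c) + E   ≡⟨ cong (_+ E) (ℕ→ℚ-+ (a ℕ.+ b) c) ⟩
      ℕ→ℚ (a ℕ.+ b) + C + E     ≡⟨ cong (λ t → t + C + E) (ℕ→ℚ-+ a b) ⟩
      A + B + C + E             ∎
    σ-rec′ : C * σ j + A * σ (suc j) + B * σ (suc (suc j)) ≡ (- (A + B + C + E)) * σ (suc j)
    σ-rec′ = subst (λ k → C * σ j + A * σ (suc j) + B * σ (suc (suc j)) ≡ (- k) * σ (suc j))
                   k≡ (σ-rec (suc j) j+1<D)
    K≡ : ℕ→ℚ (K (suc j)) ≡ A + A + E
    K≡ = trans (ℕ→ℚ-+ (a ℕ.+ a) e) (cong (_+ E) (ℕ→ℚ-+ a a))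

  τ-climbs : ∀ j → j < D → 1ℚ ℚ.≤ τ (suc j) × τ j ℚ.≤ τ (suc j)
  τ-climbs zero    0<D   = ≤-reflexive (sym (τ₁≡1 0<D)) , ≤-reflexive (trans τ₀≡1 (sym (τ₁≡1 0<D)))
  τ-climbs (suc j) j+1<D = ≤-trans 1≤τ τ≤τ′ , τ≤τ′
    where
    1≤τ : 1ℚ ℚ.≤ τ (suc j)
    1≤τ = proj₁ (τ-climbs j (<⇒≤ j+1<D))
    τ≤τ′ : τ (suc j) ℚ.≤ τ (suc (suc j))
    τ≤τ′ = nondecreasing-step (0<ℕ→ℚ (bᵢ-pos (suc j) j+1<D)) (0≤ℕ→ℚ (K (suc j))) (0≤ℕ→ℚ (cᵢ Γ (suc j)))
             (≤-trans (0≤ℕ→ℚ 1) 1≤τ) (proj₂ (τ-climbs j (<⇒≤ j+1<D))) (τ-recurrence j j+1<D)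

  flat-descends : ∀ j → suc j < D → τ (suc (suc j)) - τ (suc j) ≡ 0ℚ →
    aᵢ Γ (suc j) ≡ 0 × τ (suc j) - τ j ≡ 0ℚ
  flat-descends j j+1<D flat = a≡0 , Δ≡0
    where
    0<τ : 0ℚ ℚ.< τ (suc j)
    0<τ = <-≤-trans (0<ℕ→ℚ {1} (s≤s z≤n)) (proj₁ (τ-climbs j (<⇒≤ j+1<D)))
    B C : ℚ
    B = ℕ→ℚ (bᵢ Γ (suc j))
    C = ℕ→ℚ (cᵢ Γ (suc j))
    terms≡0 : ℕ→ℚ (K (suc j)) * τ (suc j) ≡ 0ℚ × C * (τ (suc j) - τ j) ≡ 0ℚ
    terms≡0 = nonNeg-sum≡0 (*-nonNeg (0≤ℕ→ℚ (K (suc j))) (<⇒≤ℚ 0<τ))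
                           (*-nonNeg (0≤ℕ→ℚ (cᵢ Γ (suc j))) (p≤q⇒0≤q-p (proj₂ (τ-climbs j (<⇒≤ j+1<D)))))
                           (trans (sym (τ-recurrence j j+1<D)) (trans (cong (B *_) flat) (*-zeroʳ B)))
    a≡0 : aᵢ Γ (suc j) ≡ 0
    a≡0 = m+n≡0⇒m≡0 _ (m+n≡0⇒m≡0 _ (ℕ→ℚ≡0⇒≡0 (K (suc j)) (p*q≡0⇒p≡0 0<τ (proj₁ terms≡0))))
    Δ≡0 : τ (suc j) - τ j ≡ 0ℚ
    Δ≡0 = p*q≡0⇒p≡0 (0<ℕ→ℚ (cᵢ-pos j (<⇒≤ j+1<D))) (trans (*-comm _ C) (proj₂ terms≡0))

open import Data.Nat.Properties using (+-comm; m≤o∸n⇒m+n≤o; ≤-trans; n≤1+n; <⇒≤)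
open import Data.Product using (_,_; proj₁; proj₂)
open import Relation.Binary.PropositionalEquality using (subst)
open AlternatingSign using (sum≡0⇒alternate-flat; alternate-flat⇒sum≡0)

lemma3p7 : (Γ : DRG) → 3 ≤ DRG.D Γ →
    (σ : ℕ → ℚ) → σ 0 ≡ 1ℚ →
    (∀ i → i < DRG.D Γ →
      ℕ→ℚ (cᵢ Γ i) * σ (i ∸ 1) + ℕ→ℚ (aᵢ Γ i) * σ i + ℕ→ℚ (bᵢ Γ i) * σ (suc i)
        ≡ (- ℕ→ℚ (valency Γ)) * σ i) →
    ∀ i → 1 ≤ i → i ≤ DRG.D Γ ∸ 2 →
    σ (i ∸ 1) + σ i ≡ 0ℚ → σ (suc i) + σ (suc (suc i)) ≡ 0ℚ →
    (aᵢ Γ i ≡ 0) × (aᵢ Γ (suc i) ≡ 0) × (σ i + σ (suc i) ≡ 0ℚ)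
lemma3p7 Γ 3≤D σ σ₀ σ-rec (suc m) _ i≤D∸2 _ σᵢ₊₁+σᵢ₊₂≡0 =
  proj₁ lower , proj₁ upper , alternate-flat⇒sum≡0 σ (suc m) (proj₂ upper)
  where
  open PseudoCosine Γ σ σ₀ σ-rec
  i+2≤D : suc (suc (suc m)) ≤ DRG.D Γ
  i+2≤D = subst (_≤ DRG.D Γ) (+-comm (suc m) 2) (m≤o∸n⇒m+n≤o (suc m) (≤-trans (n≤1+n 2) 3≤D) i≤D∸2)
  upper : aᵢ Γ (suc (suc m)) ≡ 0 × τ (suc (suc m)) - τ (suc m) ≡ 0ℚ
  upper = flat-descends (suc m) i+2≤D (sum≡0⇒alternate-flat σ (suc (suc m)) σᵢ₊₁+σᵢ₊₂≡0)
  lower : aᵢ Γ (suc m) ≡ 0 × τ (suc m) - τ m ≡ 0ℚ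
  lower = flat-descends m (<⇒≤ i+2≤D) (proj₂ upper)
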